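{- Let $n,m$ be positive integers. (i) If $n>m$, then $c_{n+m}+c_{n-m}=2c_nC_m$; (ii) If $n\leq m$, then $c_{n+m}-c_{m-n+1}=2c_nC_m$.
   Context: The Lucas-balancing numbers $C_k$ ($k\ge0$) are defined by $C_0=1$, $C_1=3$, $C_{k+1}=6C_k-C_{k-1}$ for $k\ge1$. The Lucas-cobalancing numbers $c_k$ ($k\ge1$) are defined by $c_1=1$, $c_2=7$, $c_{k+1}=6c_k-c_{k-1}$ for $k\ge2$. -}

module Defs where

open import Data.Nat using (ℕ; zero; suc)
open import Data.Integer using (ℤ; +_; -_; _-_; _*_)

C : ℕ → ℤ
C zero = + 1
C (suc zero) = + 3
C (suc (suc k)) = + 6 * C (suc k) - C k

-- Lucas-cobalancing numbers: c 1 = 1, c 2 = 7, c (k+2) = 6 c (k+1) - c k for k ≥ 1.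
-- c is only meaningful for k ≥ 1; the value at 0 is a filler (chosen as -1,
-- consistent with the recurrence) and is never used by the statement.
c : ℕ → ℤ
c zero = - (+ 1)
c (suc zero) = + 1
c (suc (suc zero)) = + 7
c (suc (suc (suc k))) = + 6 * c (suc (suc k)) - c (suc k)

module Submission where

-- Both identities are instances of one addition formula.
-- Call f : ℤ → ℤ recurrent if f (t + 2) = 6 f (t + 1) - f t for all t.
-- For recurrent f, every t and every k ≥ 0,
--     f (t + k) + f (t - k) = 2 f(t) C_k.
-- Indeed, as functions of k, both rays f (t + k) and f (t - k) satisfy the
-- recurrence of C; hence so do their sum and 2 f(t) C_k, and the two agree
-- at k = 0 and k = 1, so they agree everywhere.
-- The Lucas-cobalancing numbers extend to a recurrent sequence on ℤ by the
-- reflection c_{-k} = - c_{k+1}.  Taking t = n, k = m in the addition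
-- formula gives (i) when n - m ≥ 0 and, via the reflection, (ii) when
-- n - m ≤ 0.
-- The file first treats ℕ-indexed recurrent sequences (closure properties and
-- uniqueness), then ℤ-indexed ones (rays, addition formula), then the
-- extension of c, and finally the theorem.

open import Defs
open import Data.Nat using (ℕ; zero; suc; _≤_; _<_; _∸_)
open import Data.Nat as ℕ using ()
open import Data.Integer using (ℤ; +_; _+_; _-_; _*_)
open import Data.Product using (_×_)
open import Relation.Binary.PropositionalEquality using (_≡_)

open import Data.Integer using (-[1+_]; -_) renaming (suc to sucℤ)
open import Data.Integer.Properties using (+-identityʳ; m-n≡m⊖n; ⊖-≥; ⊖-≤)
open import Data.Integer.Tactic.RingSolver using (solve-∀)
open import Data.Nat.Properties using (<⇒≤)
open import Data.Product using (_,_; proj₁)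
open import Relation.Binary.PropositionalEquality
  using (refl; sym; trans; cong; cong₂; module ≡-Reasoning)

open ≡-Reasoning

Recurrence : (ℕ → ℤ) → Set
Recurrence u = ∀ k → u (suc (suc k)) ≡ + 6 * u (suc k) - u k

C-recurrence : Recurrence C
C-recurrence k = refl

recurrence-+ : ∀ {u v} → Recurrence u → Recurrence v →
  Recurrence (λ k → u k + v k)
recurrence-+ {u} {v} ru rv k = begin
  u (suc (suc k)) + v (suc (suc k))
    ≡⟨ cong₂ _+_ (ru k) (rv k) ⟩
  (+ 6 * u (suc k) - u k) + (+ 6 * v (suc k) - v k)
    ≡⟨ regroup (u (suc k)) (u k) (v (suc k)) (v k) ⟩
  + 6 * (u (suc k) + v (suc k)) - (u k + v k) ∎
  where
  regroup : ∀ a b x y → (+ 6 * a - b) + (+ 6 * x - y) ≡ + 6 * (a + x) - (b + y)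
  regroup = solve-∀

recurrence-scale : ∀ a {u} → Recurrence u → Recurrence (λ k → a * u k)
recurrence-scale a {u} ru k = begin
  a * u (suc (suc k))           ≡⟨ cong (a *_) (ru k) ⟩
  a * (+ 6 * u (suc k) - u k)   ≡⟨ distribute a (u (suc k)) (u k) ⟩
  + 6 * (a * u (suc k)) - a * u k ∎
  where
  distribute : ∀ a x y → a * (+ 6 * x - y) ≡ + 6 * (a * x) - a * y
  distribute = solve-∀

recurrence-unique : ∀ {u v} → Recurrence u → Recurrence v →
  u 0 ≡ v 0 → u 1 ≡ v 1 → ∀ k → u k ≡ v k
recurrence-unique {u} {v} ru rv u₀ u₁ k = proj₁ (agree k)
  where
  agree : ∀ k → u k ≡ v k × u (suc k) ≡ v (suc k)
  agree zero = u₀ , u₁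
  agree (suc k) with agree k
  ... | now , next = next , (begin
    u (suc (suc k))           ≡⟨ ru k ⟩
    + 6 * u (suc k) - u k     ≡⟨ cong₂ (λ x y → + 6 * x - y) next now ⟩
    + 6 * v (suc k) - v k     ≡⟨ sym (rv k) ⟩
    v (suc (suc k))           ∎)

ℤRecurrence : (ℤ → ℤ) → Set
ℤRecurrence f = ∀ t → f (sucℤ (sucℤ t)) ≡ + 6 * f (sucℤ t) - f t

step-up : ∀ t k → t + + suc k ≡ sucℤ (t + + k)
step-up t k = commute t (+ k)
  where
  commute : ∀ t x → t + (+ 1 + x) ≡ + 1 + (t + x)
  commute = solve-∀

step-down : ∀ t k → sucℤ (t - + suc k) ≡ t - + k
step-down t k = cancel t (+ k)
  where
  cancel : ∀ t x → + 1 + (t - (+ 1 + x)) ≡ t - x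
  cancel = solve-∀

forward-ray : ∀ {f} → ℤRecurrence f → ∀ t → Recurrence (λ k → f (t + + k))
forward-ray {f} rf t k = begin
  f (t + + suc (suc k))
    ≡⟨ cong f (trans (step-up t (suc k)) (cong sucℤ (step-up t k))) ⟩
  f (sucℤ (sucℤ (t + + k)))
    ≡⟨ rf (t + + k) ⟩
  + 6 * f (sucℤ (t + + k)) - f (t + + k)
    ≡⟨ cong (λ i → + 6 * f i - f (t + + k)) (sym (step-up t k)) ⟩
  + 6 * f (t + + suc k) - f (t + + k) ∎

-- The backward ray is recurrent too, since the recurrence is symmetric:
-- x = 6 y - z is equivalent to z = 6 y - x.
backward-ray : ∀ {f} → ℤRecurrence f → ∀ t → Recurrence (λ k → f (t - + k))
backward-ray {f} rf t k = reverse (f (t - + suc k)) (begin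
  f (t - + k)
    ≡⟨ cong f (sym (trans (cong sucℤ (step-down t (suc k))) (step-down t k))) ⟩
  f (sucℤ (sucℤ s))
    ≡⟨ rf s ⟩
  + 6 * f (sucℤ s) - f s
    ≡⟨ cong (λ i → + 6 * f i - f s) (step-down t (suc k)) ⟩
  + 6 * f (t - + suc k) - f s ∎)
  where
  s : ℤ
  s = t - + suc (suc k)
  reverse : ∀ {x} y {z} → x ≡ + 6 * y - z → z ≡ + 6 * y - x
  reverse y {z} refl = double-negation y z
    where
    double-negation : ∀ y z → z ≡ + 6 * y - (+ 6 * y - z)
    double-negation = solve-∀

-- Both sides are recurrent in k (the left as a sum of two rays, the right as
-- a multiple of C), so it suffices to compare them at k = 0 and k = 1.
addition-formula : ∀ {f} → ℤRecurrence f →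
  ∀ t k → f (t + + k) + f (t - + k) ≡ + 2 * f t * C k
addition-formula {f} rf t =
  recurrence-unique
    (recurrence-+ {λ k → f (t + + k)} {λ k → f (t - + k)}
      (forward-ray {f} rf t) (backward-ray {f} rf t))
    (recurrence-scale (+ 2 * f t) C-recurrence)
    at-zero at-one
  where
  t+0≡t : t + + 0 ≡ t
  t+0≡t = +-identityʳ t

  -- t - 0 is t + 0 by computation.
  at-zero : f (t + + 0) + f (t - + 0) ≡ + 2 * f t * + 1
  at-zero = begin
    f (t + + 0) + f (t + + 0) ≡⟨ cong (λ i → f i + f i) t+0≡t ⟩
    f t + f t                 ≡⟨ double (f t) ⟩
    + 2 * f t * + 1           ∎
    where
    double : ∀ x → x + x ≡ + 2 * x * + 1
    double = solve-∀

  -- The recurrence at t - 1 reads f (t + 1) + f (t - 1) = 6 f t.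
  at-one : f (t + + 1) + f (t - + 1) ≡ + 2 * f t * + 3
  at-one = begin
    f (t + + 1) + f s                 ≡⟨ cong (λ i → f i + f s) (sym s+2≡t+1) ⟩
    f (sucℤ (sucℤ s)) + f s           ≡⟨ cong (λ x → x + f s) (rf s) ⟩
    (+ 6 * f (sucℤ s) - f s) + f s    ≡⟨ cong (λ i → (+ 6 * f i - f s) + f s) s+1≡t ⟩
    (+ 6 * f t - f s) + f s           ≡⟨ cancel (f t) (f s) ⟩
    + 2 * f t * + 3                   ∎
    where
    s : ℤ
    s = t - + 1
    s+1≡t : sucℤ s ≡ t
    s+1≡t = trans (step-down t 0) t+0≡t
    s+2≡t+1 : sucℤ (sucℤ s) ≡ t + + 1
    s+2≡t+1 = trans (cong sucℤ s+1≡t)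
                    (sym (trans (step-up t 0) (cong sucℤ t+0≡t)))
    cancel : ∀ x y → (+ 6 * x - y) + y ≡ + 2 * x * + 3
    cancel = solve-∀

-- The Lucas-cobalancing numbers extended to ℤ by reflection:
-- c_{-k} = - c_{k+1} (note that already c 0 = -1 = - c 1).
cℤ : ℤ → ℤ
cℤ (+ k)     = c k
cℤ -[1+ k ]  = - c (suc (suc k))

cℤ-reflection : ∀ k → cℤ (- + k) ≡ - c (suc k)
cℤ-reflection zero    = refl
cℤ-reflection (suc k) = refl

-- The extension is recurrent on all of ℤ; on the negative side this is the
-- recurrence of c with its terms negated.
cℤ-recurrence : ℤRecurrence cℤ
cℤ-recurrence (+ zero)              = refl
cℤ-recurrence (+ suc k)             = refl
cℤ-recurrence -[1+ zero ]           = refl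
cℤ-recurrence -[1+ suc zero ]       = refl
cℤ-recurrence -[1+ suc (suc k) ]    =
  negate (c (suc (suc k))) (c (suc (suc (suc k))))
  where
  negate : ∀ x y → - x ≡ + 6 * (- y) - (- (+ 6 * y - x))
  negate = solve-∀

cℤ-difference-≥ : ∀ {n m} → m ≤ n → cℤ (+ n - + m) ≡ c (n ∸ m)
cℤ-difference-≥ {n} {m} m≤n =
  cong cℤ (trans (m-n≡m⊖n n m) (⊖-≥ m≤n))

cℤ-difference-≤ : ∀ {n m} → n ≤ m → cℤ (+ n - + m) ≡ - c (suc (m ∸ n))
cℤ-difference-≤ {n} {m} n≤m =
  trans (cong cℤ (trans (m-n≡m⊖n n m) (⊖-≤ n≤m))) (cℤ-reflection (m ∸ n))

mainTheorem8 : (n m : ℕ) → 1 ≤ n → 1 ≤ m →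
    ((m < n → c (n ℕ.+ m) + c (n ∸ m) ≡ + 2 * c n * C m)
    × (n ≤ m → c (n ℕ.+ m) - c (suc (m ∸ n)) ≡ + 2 * c n * C m))
mainTheorem8 n m _ _ = part-i , part-ii
  where
  formula : c (n ℕ.+ m) + cℤ (+ n - + m) ≡ + 2 * c n * C m
  formula = addition-formula {cℤ} cℤ-recurrence (+ n) m

  part-i : m < n → c (n ℕ.+ m) + c (n ∸ m) ≡ + 2 * c n * C m
  part-i m<n =
    trans (cong (λ x → c (n ℕ.+ m) + x) (sym (cℤ-difference-≥ (<⇒≤ m<n)))) formula

  part-ii : n ≤ m → c (n ℕ.+ m) - c (suc (m ∸ n)) ≡ + 2 * c n * C m
  part-ii n≤m =
    trans (cong (λ x → c (n ℕ.+ m) + x) (sym (cℤ-difference-≤ n≤m))) formula
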